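{- Let $r\ge1$ and let $D_r$ be the $r\times(2r-1)$ matrix with columns indexed by $0,1,\dots,2r-2$ whose first row has a single entry $1$ in column $r-1$ and zeros elsewhere, and whose $k$th row ($2\le k\le r$) has entries $1$ in columns $r-k$ and $r-2+k$ and zeros elsewhere. For a partition $\lambda$ of length at most $r$, let $I(\lambda)=\{\lambda_r,\lambda_{r-1}+1,\dots,\lambda_1+r-1\}$ and let $\Delta_{I(\lambda)}(D_r)$ be the $r\times r$ submatrix of $D_r$ formed by the columns indexed by $I(\lambda)$ in increasing order. Then $$\det\Delta_{I(\lambda)}(D_r)=\begin{cases}(-1)^{r(r-1)/2+|\lambda|/2} & \text{if } \lambda\in\mathcal{P}_r,\\ 0&\text{otherwise.}\end{cases}$$
   Context: Partitions in Frobenius notation: $(\alpha_1,\dots,\alpha_p\,|\,\beta_1,\dots,\beta_p)$ with $p$ the number of diagonal boxes, $\alpha_i=\lambda_i-i$, $\beta_i=\lambda'_i-i$. $\mathcal{P}_r$ is the set of partitions of the form $(\alpha_1,\dots,\alpha_p\,|\,\alpha_1+1,\dots,\alpha_p+1)$ with $p\ge0$ and length at most $r$ (the empty partition included). Convention: if $I(\lambda)\not\subseteq\{0,\dots,2r-2\}$, the determinant $\det\Delta_{I(\lambda)}(D_r)$ is taken to be $0$. -}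

module Defs where

open import Data.Nat as ℕ using (ℕ; zero; suc; _+_; _*_; _∸_; _/_; _<_; _≤_; _≤?_; _<?_)
open import Data.Fin as Fin using (Fin; toℕ; fromℕ<; punchIn; opposite)
open import Data.Fin.Properties using (all?)
open import Data.Integer as ℤ using (ℤ; +_; -1ℤ; 0ℤ; 1ℤ)
open import Data.Bool using (Bool; true; false; if_then_else_; _∨_)
open import Relation.Nullary using (Dec; yes; no; ¬_)
open import Relation.Nullary.Decidable using (⌊_⌋)
open import Data.Product using (_×_)
open import Relation.Binary.PropositionalEquality using (_≡_)

sumFin : ∀ n → (Fin n → ℤ) → ℤ
sumFin zero    f = 0ℤ
sumFin (suc n) f = f Fin.zero ℤ.+ sumFin n (λ i → f (Fin.suc i))

det : ∀ n → (Fin n → Fin n → ℤ) → ℤ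
det zero    M = 1ℤ
det (suc n) M =
  sumFin (suc n) (λ j → (-1ℤ ℤ.^ toℕ j) ℤ.* (M Fin.zero j ℤ.* det n (λ a b → M (Fin.suc a) (punchIn j b))))

-- A partition of length at most r: λ i = λ_{i+1} (i : Fin r), weakly decreasing, entries ≥ 0.
IsPartition : ∀ r → (Fin r → ℕ) → Set
IsPartition r λ′ = ∀ (i j : Fin r) → i Fin.≤ j → λ′ j ≤ λ′ i

size : ∀ r → (Fin r → ℕ) → ℕ
size zero    λ′ = 0
size (suc r) λ′ = λ′ Fin.zero + size r (λ i → λ′ (Fin.suc i))

countGE : ∀ r → ℕ → (Fin r → ℕ) → ℕ
countGE zero    m λ′ = 0
countGE (suc r) m λ′ =
  (if ⌊ m ≤? λ′ Fin.zero ⌋ then 1 else 0) + countGE r m (λ i → λ′ (Fin.suc i))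

-- conjugate partition: conj r λ k = λ'_k = #{ i : λ_i ≥ k }  (for k ≥ 1)
conj : ∀ r → (Fin r → ℕ) → ℕ → ℕ
conj r λ′ k = countGE r k λ′

-- Frobenius coordinates (1-based index i = toℕ i₀ + 1):
-- α_i = λ_i − i,  β_i = λ'_i − i ; the diagonal boxes are the i with λ_i ≥ i.
frobα : ∀ r → (Fin r → ℕ) → Fin r → ℕ
frobα r λ′ i = λ′ i ∸ suc (toℕ i)

frobβ : ∀ r → (Fin r → ℕ) → Fin r → ℕ
frobβ r λ′ i = conj r λ′ (suc (toℕ i)) ∸ suc (toℕ i)

OnDiagonal : ∀ r → (Fin r → ℕ) → Fin r → Set
OnDiagonal r λ′ i = suc (toℕ i) ≤ λ′ i

-- λ ∈ 𝒫_r : Frobenius form (α_1..α_p | α_1+1..α_p+1)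
InP : ∀ r → (Fin r → ℕ) → Set
InP r λ′ = ∀ (i : Fin r) → OnDiagonal r λ′ i → frobβ r λ′ i ≡ frobα r λ′ i + 1

-- The r × (2r−1) matrix D_r ; rows k = toℕ k₀ + 1, columns 0..2r−2.
-- row 1: a 1 in column r−1 ; row k ≥ 2: 1's in columns r−k and r−2+k.
Dmat : ∀ r → Fin r → Fin (2 * r ∸ 1) → ℤ
Dmat r k c with toℕ k
... | zero  = if ⌊ toℕ c ℕ.≟ (r ∸ 1) ⌋ then 1ℤ else 0ℤ
... | suc k′ = if ⌊ toℕ c ℕ.≟ (r ∸ (k′ + 2)) ⌋ ∨ ⌊ toℕ c ℕ.≟ (r + k′) ⌋ then 1ℤ else 0ℤ

-- I(λ) = {λ_r, λ_{r−1}+1, …, λ_1+r−1}, listed in increasing order: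
-- the j-th element (j = 0..r−1) is λ_{r−j} + j.
Icol : ∀ r → (Fin r → ℕ) → Fin r → ℕ
Icol r λ′ j = λ′ (opposite j) + toℕ j

-- det Δ_{I(λ)}(D_r), with the convention that it is 0 if I(λ) ⊄ {0,…,2r−2}.
detΔ : ∀ r → (Fin r → ℕ) → ℤ
detΔ r λ′ with all? (λ j → Icol r λ′ j <? (2 * r ∸ 1))
... | yes inR = det r (λ k j → Dmat r k (fromℕ< (inR j)))
... | no  _   = 0ℤ

signP : ∀ r → (Fin r → ℕ) → ℤ
signP r λ′ = -1ℤ ℤ.^ (r * (r ∸ 1) / 2 + size r λ′ / 2)

-- Column c of D_r is the unit vector at row ∣c − (r − 1)∣, so Δ_{I(λ)}(D_r) has unit columns:
-- writing g x = λ_{x+1}, the column coming from row x of λ has its 1 in row ∣g x − x∣.  As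
-- g x − x is strictly decreasing, g has at most one fixed point i; without one the first row
-- of the matrix vanishes and λ ∉ 𝒫_r.  Otherwise expanding along the first row deletes the column of i and
-- lowers every other distance by one, which amounts to passing to the partition g′ obtained by
-- deleting row i and shortening each earlier row by one box, at the cost of a sign
-- (−1)^(r − 1 − i); since |λ| = |g′| + 2i this matches the claimed sign.  The condition
-- β = α + 1 holds for g iff it holds for g′, unless g (i − 1) = g (i + 1) = i, in which case it
-- fails for g and g′ has two fixed points, so the determinant is 0.  Induct on r.

module Submission where

open import Defs
open import Data.Nat as ℕ
  using (ℕ; zero; suc; pred; z<s; >-nonZero; _+_; _*_; _∸_; _/_; _<_; _≤_; _≤?_; _<?_; z≤n; s≤s; ∣_-_∣)
open import Data.Nat.Properties
open import Data.Nat.DivMod using (+-distrib-/-∣ʳ; m*n/n≡m)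
open import Data.Nat.Divisibility using (divides)
open import Data.Nat.Tactic.RingSolver using (solve-∀)
open import Data.Fin as Fin using (Fin; zero; suc; toℕ; fromℕ<; punchIn; punchOut; opposite)
open import Data.Fin.Properties
  using (toℕ-fromℕ<; fromℕ<-toℕ; toℕ-injective; toℕ<n; all?; opposite-prop; punchInᵢ≢i; punchIn-punchOut)
  renaming (suc-injective to Fin-suc-injective)
open import Data.Integer as ℤ using (ℤ; 0ℤ; 1ℤ; -1ℤ)
import Data.Integer.Properties as ℤP
open import Data.Bool using (if_then_else_)
open import Data.Empty using (⊥-elim)
open import Data.Product using (Σ; ∃; _×_; _,_; proj₁; proj₂)
open import Data.Sum using (_⊎_; inj₁; inj₂; [_,_])
open import Function using (_∘_)
open import Relation.Nullary using (Dec; yes; no; ¬_; _×-dec_)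
open import Relation.Nullary.Decidable using (⌊_⌋)
open import Relation.Binary.PropositionalEquality hiding ([_])

sumFin-cong : ∀ n {f h : Fin n → ℤ} → (∀ j → f j ≡ h j) → sumFin n f ≡ sumFin n h
sumFin-cong zero    f≗h = refl
sumFin-cong (suc n) f≗h = cong₂ ℤ._+_ (f≗h zero) (sumFin-cong n (f≗h ∘ suc))

sumFin-zero : ∀ n {f : Fin n → ℤ} → (∀ j → f j ≡ 0ℤ) → sumFin n f ≡ 0ℤ
sumFin-zero zero    f≗0 = refl
sumFin-zero (suc n) f≗0 = cong₂ ℤ._+_ (f≗0 zero) (sumFin-zero n (f≗0 ∘ suc))

sumFin-single : ∀ n {f : Fin n → ℤ} j₀ → (∀ j → j ≢ j₀ → f j ≡ 0ℤ) → sumFin n f ≡ f j₀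
sumFin-single (suc n) {f} zero f≗0 = begin
  f zero ℤ.+ sumFin n (f ∘ suc) ≡⟨ cong (λ s → f zero ℤ.+ s) (sumFin-zero n (λ j → f≗0 (suc j) λ ())) ⟩
  f zero ℤ.+ 0ℤ                 ≡⟨ ℤP.+-identityʳ (f zero) ⟩
  f zero                        ∎
  where open ≡-Reasoning
sumFin-single (suc n) {f} (suc j₀) f≗0 = begin
  f zero ℤ.+ sumFin n (f ∘ suc) ≡⟨ cong (λ x → x ℤ.+ sumFin n (f ∘ suc)) (f≗0 zero λ ()) ⟩
  0ℤ ℤ.+ sumFin n (f ∘ suc)     ≡⟨ ℤP.+-identityˡ _ ⟩
  sumFin n (f ∘ suc)            ≡⟨ sumFin-single n j₀ (λ j j≢j₀ → f≗0 (suc j) (j≢j₀ ∘ Fin-suc-injective)) ⟩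
  f (suc j₀)                    ∎
  where open ≡-Reasoning

Matrix : ℕ → Set
Matrix n = Fin n → Fin n → ℤ

minor : ∀ {n} → Matrix (suc n) → Fin (suc n) → Matrix n
minor M j a b = M (suc a) (punchIn j b)

cofactorTerm : ∀ {n} → Matrix (suc n) → Fin (suc n) → ℤ
cofactorTerm {n} M j = (-1ℤ ℤ.^ toℕ j) ℤ.* (M zero j ℤ.* det n (minor M j))

cofactorTerm-zeroEntry : ∀ {n} (M : Matrix (suc n)) j → M zero j ≡ 0ℤ → cofactorTerm M j ≡ 0ℤ
cofactorTerm-zeroEntry M j M₀ⱼ≡0 rewrite M₀ⱼ≡0 = ℤP.*-zeroʳ (-1ℤ ℤ.^ toℕ j)

cofactorTerm-zeroMinor : ∀ {n} (M : Matrix (suc n)) j → det n (minor M j) ≡ 0ℤ → cofactorTerm M j ≡ 0ℤ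
cofactorTerm-zeroMinor M j minor≡0
  rewrite minor≡0 | ℤP.*-zeroʳ (M zero j) = ℤP.*-zeroʳ (-1ℤ ℤ.^ toℕ j)

det-cong : ∀ n {M N : Matrix n} → (∀ a b → M a b ≡ N a b) → det n M ≡ det n N
det-cong zero    M≗N = refl
det-cong (suc n) M≗N = sumFin-cong (suc n) λ j →
  cong₂ (λ x y → (-1ℤ ℤ.^ toℕ j) ℤ.* (x ℤ.* y))
        (M≗N zero j) (det-cong n (λ a b → M≗N (suc a) (punchIn j b)))

det-zeroFirstRow : ∀ n (M : Matrix (suc n)) → (∀ j → M zero j ≡ 0ℤ) → det (suc n) M ≡ 0ℤ
det-zeroFirstRow n M row≡0 = sumFin-zero (suc n) {cofactorTerm M} λ j → cofactorTerm-zeroEntry M j (row≡0 j)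

det-zeroColumn : ∀ n (M : Matrix n) c → (∀ a → M a c ≡ 0ℤ) → det n M ≡ 0ℤ
det-zeroColumn (suc n) M c col≡0 = sumFin-zero (suc n) {cofactorTerm M} term≡0
  where
  term≡0 : ∀ j → cofactorTerm M j ≡ 0ℤ
  term≡0 j with j Fin.≟ c
  ... | yes refl = cofactorTerm-zeroEntry M j (col≡0 zero)
  ... | no  j≢c  = cofactorTerm-zeroMinor M j (det-zeroColumn n (minor M j) (punchOut j≢c)
                     λ a → trans (cong (M (suc a)) (punchIn-punchOut j≢c)) (col≡0 (suc a)))

unit : ℕ → ℕ → ℤ
unit k m = if ⌊ k ℕ.≟ m ⌋ then 1ℤ else 0ℤ

unit-≢ : ∀ {k m} → k ≢ m → unit k m ≡ 0ℤ
unit-≢ {k} {m} k≢m with k ℕ.≟ m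
... | yes k≡m = ⊥-elim (k≢m k≡m)
... | no  _   = refl

unit-refl : ∀ k → unit k k ≡ 1ℤ
unit-refl k with k ℕ.≟ k
... | yes _   = refl
... | no  k≢k = ⊥-elim (k≢k refl)

unit-suc : ∀ k m → unit (suc k) (suc m) ≡ unit k m
unit-suc k m with k ℕ.≟ m
... | yes refl = unit-refl (suc k)
... | no  k≢m  = unit-≢ (k≢m ∘ suc-injective)

unitColumns : ∀ n → (Fin n → ℕ) → Matrix n
unitColumns n f k j = unit (toℕ k) (f j)

det-unitColumns-noZero : ∀ n (f : Fin (suc n) → ℕ) → (∀ j → f j ≢ 0) → det (suc n) (unitColumns (suc n) f) ≡ 0ℤ
det-unitColumns-noZero n f f≢0 = det-zeroFirstRow n (unitColumns (suc n) f) λ j → unit-≢ (f≢0 j ∘ sym)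

det-unitColumns-twoZeros : ∀ n (f : Fin n → ℕ) {j₁ j₂} → j₁ ≢ j₂ → f j₁ ≡ 0 → f j₂ ≡ 0 →
                           det n (unitColumns n f) ≡ 0ℤ
det-unitColumns-twoZeros (suc n) f {j₁} {j₂} j₁≢j₂ fj₁≡0 fj₂≡0 = sumFin-zero (suc n) {cofactorTerm U} term≡0
  where
  U = unitColumns (suc n) f
  anotherZero : ∀ j → Σ (Fin (suc n)) λ j′ → j ≢ j′ × f j′ ≡ 0
  anotherZero j with j Fin.≟ j₁
  ... | yes refl = j₂ , j₁≢j₂ , fj₂≡0
  ... | no  j≢j₁ = j₁ , j≢j₁ , fj₁≡0
  term≡0 : ∀ j → cofactorTerm U j ≡ 0ℤ
  term≡0 j with f j ℕ.≟ 0 | anotherZero j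
  ... | no  fj≢0 | _ = cofactorTerm-zeroEntry U j (unit-≢ (fj≢0 ∘ sym))
  ... | yes _    | j′ , j≢j′ , fj′≡0 = cofactorTerm-zeroMinor U j
        (det-zeroColumn n (minor U j) (punchOut j≢j′) λ a →
           trans (cong (U (suc a)) (punchIn-punchOut j≢j′))
                 (unit-≢ λ 1+a≡fj′ → 1+n≢0 (trans 1+a≡fj′ fj′≡0)))

det-unitColumns-expand : ∀ n (f : Fin (suc n) → ℕ) j₀ → f j₀ ≡ 0 → (∀ j → j ≢ j₀ → f j ≢ 0) →
  det (suc n) (unitColumns (suc n) f) ≡ (-1ℤ ℤ.^ toℕ j₀) ℤ.* det n (unitColumns n (λ b → f (punchIn j₀ b) ∸ 1))
det-unitColumns-expand n f j₀ fj₀≡0 f≢0 = begin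
  det (suc n) U
    ≡⟨ sumFin-single (suc n) {cofactorTerm U} j₀ (λ j j≢j₀ →
         cofactorTerm-zeroEntry U j (unit-≢ (f≢0 j j≢j₀ ∘ sym))) ⟩
  ε ℤ.* (U zero j₀ ℤ.* det n (minor U j₀))
    ≡⟨ cong (λ x → ε ℤ.* (x ℤ.* det n (minor U j₀))) (trans (cong (unit 0) fj₀≡0) (unit-refl 0)) ⟩
  ε ℤ.* (1ℤ ℤ.* det n (minor U j₀))
    ≡⟨ cong (ε ℤ.*_) (ℤP.*-identityˡ _) ⟩
  ε ℤ.* det n (minor U j₀)
    ≡⟨ cong (ε ℤ.*_) (det-cong n λ a b → lowerRow a (punchIn j₀ b) (f≢0 _ (punchInᵢ≢i j₀ b))) ⟩
  ε ℤ.* det n (unitColumns n (λ b → f (punchIn j₀ b) ∸ 1))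
    ∎
  where
  open ≡-Reasoning
  U = unitColumns (suc n) f
  ε = -1ℤ ℤ.^ toℕ j₀
  lowerRow : ∀ a j → f j ≢ 0 → U (suc a) j ≡ unit (toℕ a) (f j ∸ 1)
  lowerRow a j fj≢0 with f j
  ... | zero  = ⊥-elim (fj≢0 refl)
  ... | suc m = unit-suc (toℕ a) m

toℕ-punchIn-< : ∀ {m} (i : Fin (suc m)) (j : Fin m) → toℕ j < toℕ i → toℕ (punchIn i j) ≡ toℕ j
toℕ-punchIn-< (suc i) zero    _         = refl
toℕ-punchIn-< (suc i) (suc j) (s≤s j<i) = cong suc (toℕ-punchIn-< i j j<i)

toℕ-punchIn-≥ : ∀ {m} (i : Fin (suc m)) (j : Fin m) → toℕ i ≤ toℕ j → toℕ (punchIn i j) ≡ suc (toℕ j)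
toℕ-punchIn-≥ zero    j       _         = refl
toℕ-punchIn-≥ (suc i) (suc j) (s≤s i≤j) = cong suc (toℕ-punchIn-≥ i j i≤j)

count : ℕ → ℕ → (ℕ → ℕ) → ℕ
count zero    m g = 0
count (suc k) m g = (if ⌊ m ≤? g 0 ⌋ then 1 else 0) + count k m (g ∘ suc)

count-head : ∀ k m g → m ≤ g 0 → count (suc k) m g ≡ suc (count k m (g ∘ suc))
count-head k m g m≤g0 with m ≤? g 0
... | yes _    = refl
... | no  m≰g0 = ⊥-elim (m≰g0 m≤g0)

count-cong : ∀ k m {g h} → (∀ x → x < k → g x ≡ h x) → count k m g ≡ count k m h
count-cong zero    m g≗h = refl
count-cong (suc k) m g≗h rewrite g≗h 0 (s≤s z≤n) =
  cong (_ +_) (count-cong k m λ x x<k → g≗h (suc x) (s≤s x<k))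

count-split : ∀ a b m g → count (a + b) m g ≡ count a m g + count b m (λ x → g (a + x))
count-split zero    b m g = refl
count-split (suc a) b m g rewrite count-split a b m (g ∘ suc) =
  sym (+-assoc (if ⌊ m ≤? g 0 ⌋ then 1 else 0) _ _)

count-all : ∀ k m g → (∀ x → x < k → m ≤ g x) → count k m g ≡ k
count-all zero    m g all≥ = refl
count-all (suc k) m g all≥ rewrite count-head k m g (all≥ 0 (s≤s z≤n)) =
  cong suc (count-all k m (g ∘ suc) λ x x<k → all≥ (suc x) (s≤s x<k))

count-none : ∀ k m g → (∀ x → x < k → g x < m) → count k m g ≡ 0
count-none zero    m g all< = refl
count-none (suc k) m g all< with m ≤? g 0
... | yes m≤g0 = ⊥-elim (<⇒≱ (all< 0 (s≤s z≤n)) m≤g0)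
... | no  _    = count-none k m (g ∘ suc) λ x x<k → all< (suc x) (s≤s x<k)

count-≤ : ∀ k m g → count k m g ≤ k
count-≤ zero    m g = z≤n
count-≤ (suc k) m g with m ≤? g 0
... | yes _ = s≤s (count-≤ k m (g ∘ suc))
... | no  _ = m≤n⇒m≤1+n (count-≤ k m (g ∘ suc))

count-pos : ∀ k m g x → x < k → m ≤ g x → 0 < count k m g
count-pos (suc k) m g zero    _         m≤gx rewrite count-head k m g m≤gx = z<s
count-pos (suc k) m g (suc x) (s≤s x<k) m≤gx =
  ≤-trans (count-pos k m (g ∘ suc) x x<k m≤gx) (m≤n+m _ _)

count-threshold : ∀ k r m g → k ≤ r → (∀ y → y < k → m ≤ g y) → (∀ y → k ≤ y → y < r → g y < m) →
                  count r m g ≡ k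
count-threshold k r m g k≤r high low = begin
  count r m g                                                ≡⟨ cong (λ l → count l m g) (m+[n∸m]≡n k≤r) ⟨
  count (k + (r ∸ k)) m g                                    ≡⟨ count-split k (r ∸ k) m g ⟩
  count k m g + count (r ∸ k) m (λ y → g (k + y))            ≡⟨ cong₂ _+_ (count-all k m g high)
                                                                 (count-none (r ∸ k) m _ λ y y<r∸k →
                                                                   low (k + y) (m≤m+n k y) (below y y<r∸k)) ⟩
  k + 0                                                      ≡⟨ +-identityʳ k ⟩
  k                                                          ∎
  where
  open ≡-Reasoning
  below : ∀ y → y < r ∸ k → k + y < r
  below y y<r∸k = subst (k + y <_) (m+[n∸m]≡n k≤r) (+-monoʳ-< k y<r∸k)

sumUpTo : ℕ → (ℕ → ℕ) → ℕ
sumUpTo zero    g = 0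
sumUpTo (suc k) g = g 0 + sumUpTo k (g ∘ suc)

sumUpTo-cong : ∀ k {g h} → (∀ x → x < k → g x ≡ h x) → sumUpTo k g ≡ sumUpTo k h
sumUpTo-cong zero    g≗h = refl
sumUpTo-cong (suc k) g≗h = cong₂ _+_ (g≗h 0 (s≤s z≤n)) (sumUpTo-cong k λ x x<k → g≗h (suc x) (s≤s x<k))

sumUpTo-split : ∀ a b g → sumUpTo (a + b) g ≡ sumUpTo a g + sumUpTo b (λ x → g (a + x))
sumUpTo-split zero    b g = refl
sumUpTo-split (suc a) b g rewrite sumUpTo-split a b (g ∘ suc) = sym (+-assoc (g 0) _ _)

sumUpTo-pred : ∀ k g → (∀ x → x < k → 1 ≤ g x) → sumUpTo k (λ x → g x ∸ 1) + k ≡ sumUpTo k g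
sumUpTo-pred zero    g pos = refl
sumUpTo-pred (suc k) g pos = begin
  (g 0 ∸ 1 + S′) + suc k     ≡⟨ +-suc _ k ⟩
  suc ((g 0 ∸ 1 + S′) + k)   ≡⟨ cong suc (+-assoc (g 0 ∸ 1) S′ k) ⟩
  suc (g 0 ∸ 1 + (S′ + k))   ≡⟨ cong (λ s → suc (g 0 ∸ 1 + s)) (sumUpTo-pred k (g ∘ suc) λ x x<k → pos (suc x) (s≤s x<k)) ⟩
  suc (g 0 ∸ 1) + S          ≡⟨ cong (_+ S) (m+[n∸m]≡n (pos 0 (s≤s z≤n))) ⟩
  g 0 + S                    ∎
  where
  open ≡-Reasoning
  S  = sumUpTo k (g ∘ suc)
  S′ = sumUpTo k (λ x → g (suc x) ∸ 1)

[m+[k+k]]/2≡m/2+k : ∀ m k → (m + (k + k)) / 2 ≡ m / 2 + k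
[m+[k+k]]/2≡m/2+k m k = begin
  (m + (k + k)) / 2   ≡⟨ +-distrib-/-∣ʳ m (divides k (k+k≡k*2 k)) ⟩
  m / 2 + (k + k) / 2 ≡⟨ cong (λ x → m / 2 + x / 2) (k+k≡k*2 k) ⟩
  m / 2 + k * 2 / 2   ≡⟨ cong (m / 2 +_) (m*n/n≡m k 2) ⟩
  m / 2 + k           ∎
  where
  open ≡-Reasoning
  k+k≡k*2 : ∀ k → k + k ≡ k * 2
  k+k≡k*2 = solve-∀

[1+n]*n≡n*[n∸1]+[n+n] : ∀ n → suc n * n ≡ n * (n ∸ 1) + (n + n)
[1+n]*n≡n*[n∸1]+[n+n] zero    = refl
[1+n]*n≡n*[n∸1]+[n+n] (suc n) = lemma n
  where
  lemma : ∀ n → suc (suc n) * suc n ≡ suc n * n + (suc n + suc n)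
  lemma = solve-∀

-1^[m+[k+k]]≡-1^m : ∀ m k → -1ℤ ℤ.^ (m + (k + k)) ≡ -1ℤ ℤ.^ m
-1^[m+[k+k]]≡-1^m m k = begin
  -1ℤ ℤ.^ (m + (k + k))           ≡⟨ ℤP.^-distribˡ-+-* -1ℤ m (k + k) ⟩
  -1ℤ ℤ.^ m ℤ.* -1ℤ ℤ.^ (k + k)   ≡⟨ cong (λ x → -1ℤ ℤ.^ m ℤ.* -1ℤ ℤ.^ (k + x)) (sym (+-identityʳ k)) ⟩
  -1ℤ ℤ.^ m ℤ.* -1ℤ ℤ.^ (2 * k)   ≡⟨ cong (λ x → -1ℤ ℤ.^ m ℤ.* x) (sym (ℤP.^-*-assoc -1ℤ 2 k)) ⟩
  -1ℤ ℤ.^ m ℤ.* 1ℤ ℤ.^ k          ≡⟨ cong (λ x → -1ℤ ℤ.^ m ℤ.* x) (ℤP.^-zeroˡ k) ⟩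
  -1ℤ ℤ.^ m ℤ.* 1ℤ                ≡⟨ ℤP.*-identityʳ _ ⟩
  -1ℤ ℤ.^ m                       ∎
  where open ≡-Reasoning

∣m∸1-n∣≡∣m-n∣∸1 : ∀ {m n} → n < m → ∣ m ∸ 1 - n ∣ ≡ ∣ m - n ∣ ∸ 1
∣m∸1-n∣≡∣m-n∣∸1 {suc m} {n} (s≤s n≤m) = begin
  ∣ m - n ∣           ≡⟨ m≤n⇒∣n-m∣≡n∸m n≤m ⟩
  m ∸ n               ≡⟨ cong (_∸ 1) (+-∸-assoc 1 n≤m) ⟨
  suc m ∸ n ∸ 1       ≡⟨ cong (_∸ 1) (m≤n⇒∣n-m∣≡n∸m (m≤n⇒m≤1+n n≤m)) ⟨
  ∣ suc m - n ∣ ∸ 1   ∎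
  where open ≡-Reasoning

∣m-n∣≡∣m-1+n∣∸1 : ∀ {m n} → m ≤ n → ∣ m - n ∣ ≡ ∣ m - suc n ∣ ∸ 1
∣m-n∣≡∣m-1+n∣∸1 {m} {n} m≤n = begin
  ∣ m - n ∣           ≡⟨ m≤n⇒∣m-n∣≡n∸m m≤n ⟩
  n ∸ m               ≡⟨ cong (_∸ 1) (+-∸-assoc 1 m≤n) ⟨
  suc n ∸ m ∸ 1       ≡⟨ cong (_∸ 1) (m≤n⇒∣m-n∣≡n∸m (m≤n⇒m≤1+n m≤n)) ⟨
  ∣ m - suc n ∣ ∸ 1   ∎
  where open ≡-Reasoning

m<n∸1⇒1+m<n : ∀ {m n} → m < n ∸ 1 → suc m < n
m<n∸1⇒1+m<n {n = suc n} m<n = s≤s m<n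

1+pred : ∀ {m} → 1 ≤ m → suc (pred m) ≡ m
1+pred 1≤m = suc-pred _ {{>-nonZero 1≤m}}

1+n∸o≡n∸o+1 : ∀ {n o} → o ≤ n → suc n ∸ o ≡ n ∸ o + 1
1+n∸o≡n∸o+1 o≤n = trans (+-∸-assoc 1 o≤n) (+-comm 1 _)

m∸o≡n∸o+1⇒m≡1+n : ∀ {m n o} → o ≤ m → o ≤ n → m ∸ o ≡ n ∸ o + 1 → m ≡ suc n
m∸o≡n∸o+1⇒m≡1+n {m} {n} {o} o≤m o≤n eq = begin
  m               ≡⟨ m∸n+n≡m o≤m ⟨
  m ∸ o + o       ≡⟨ cong (_+ o) (trans eq (sym (1+n∸o≡n∸o+1 o≤n))) ⟩
  suc n ∸ o + o   ≡⟨ m∸n+n≡m (m≤n⇒m≤1+n o≤n) ⟩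
  suc n           ∎
  where open ≡-Reasoning

m<r⇒n<r⇒m+n<2r∸1 : ∀ {m n r} → m < r → n < r → m + n < 2 * r ∸ 1
m<r⇒n<r⇒m+n<2r∸1 {m} {n} {suc r} (s≤s m≤r) (s≤s n≤r) =
  ≤-trans (s≤s (+-mono-≤ m≤r n≤r)) (≤-reflexive (lemma r))
  where
  lemma : ∀ r → suc (r + r) ≡ r + suc (r + 0)
  lemma = solve-∀

m∸[1+n]+n≡m∸1 : ∀ {m n} → n < m → m ∸ suc n + n ≡ m ∸ 1
m∸[1+n]+n≡m∸1 {suc m} (s≤s n≤m) = m∸n+n≡m n≤m

∣m∸[1+k]-m∣≡1+k : ∀ {k m} → k < m → ∣ m ∸ suc k - m ∣ ≡ suc k
∣m∸[1+k]-m∣≡1+k {k} {m} k<m = trans (m≤n⇒∣m-n∣≡n∸m (m∸n≤m m (suc k))) (m∸[m∸n]≡n k<m)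

∣1+m+k-m∣≡1+k : ∀ k m → ∣ suc m + k - m ∣ ≡ suc k
∣1+m+k-m∣≡1+k k m = begin
  ∣ suc m + k - m ∣  ≡⟨ ∣-∣-comm (suc m + k) m ⟩
  ∣ m - suc m + k ∣  ≡⟨ cong (λ z → ∣ m - z ∣) (+-suc m k) ⟨
  ∣ m - m + suc k ∣  ≡⟨ ∣m-m+n∣≡n m (suc k) ⟩
  suc k              ∎
  where open ≡-Reasoning

∣x-m∣≡1+k⇒ : ∀ {x m k} → ∣ x - m ∣ ≡ suc k → x ≡ m ∸ suc k ⊎ x ≡ suc m + k
∣x-m∣≡1+k⇒ {x} {m} {k} d≡1+k with ∣m-n∣≡[m∸n]∨[n∸m] x m
... | inj₁ d≡x∸m = inj₂ (begin
  x                 ≡⟨ m∸n+n≡m m≤x ⟨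
  x ∸ m + m         ≡⟨ cong (_+ m) (trans (sym d≡x∸m) d≡1+k) ⟩
  suc k + m         ≡⟨ +-comm (suc k) m ⟩
  m + suc k         ≡⟨ +-suc m k ⟩
  suc m + k         ∎)
  where
  open ≡-Reasoning
  m≤x = <⇒≤ (m∸n≢0⇒n<m {x} {m} λ x∸m≡0 → 1+n≢0 (trans (sym d≡1+k) (trans d≡x∸m x∸m≡0)))
... | inj₂ d≡m∸x = inj₁ (begin
  x                 ≡⟨ m∸[m∸n]≡n x≤m ⟨
  m ∸ (m ∸ x)       ≡⟨ cong (m ∸_) (trans (sym d≡m∸x) d≡1+k) ⟩
  m ∸ suc k         ∎)
  where
  open ≡-Reasoning
  x≤m = <⇒≤ (m∸n≢0⇒n<m {m} {x} λ m∸x≡0 → 1+n≢0 (trans (sym d≡1+k) (trans d≡m∸x m∸x≡0)))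

lastSatisfying : ∀ {P : ℕ → Set} → (∀ x → Dec (P x)) → ∀ n → P 0 →
                 ∃ λ x → x ≤ n × P x × (x ≡ n ⊎ ¬ P (suc x))
lastSatisfying P? zero    P0 = 0 , z≤n , P0 , inj₁ refl
lastSatisfying P? (suc n) P0 with lastSatisfying P? n P0
... | x , x≤n , Px , inj₂ ¬Px+1 = x , m≤n⇒m≤1+n x≤n , Px , inj₂ ¬Px+1
... | x , x≤n , Px , inj₁ refl with P? (suc x)
...   | yes Px+1 = suc x , ≤-refl , Px+1 , inj₁ refl
...   | no ¬Px+1 = x , n≤1+n x , Px , inj₂ ¬Px+1

Decreasing : ℕ → (ℕ → ℕ) → Set
Decreasing r g = ∀ x y → x ≤ y → y < r → g y ≤ g x

-- With g x = λ_{x+1}, count r (suc x) g is λ′_{x+1}: this is β = α + 1 on the diagonal.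
LegIsArmPlusOne : ℕ → (ℕ → ℕ) → Set
LegIsArmPlusOne r g = ∀ x → x < r → suc x ≤ g x → count r (suc x) g ≡ suc (g x)

distance : (ℕ → ℕ) → ℕ → ℕ
distance g x = ∣ g x - x ∣

-- Column j of Δ_{I(λ)}(D_r) comes from row r − 1 − j of λ (see distance-Icol).
distances : ∀ r → (ℕ → ℕ) → Fin r → ℕ
distances r g j = distance g (r ∸ suc (toℕ j))

Δ : ℕ → (ℕ → ℕ) → ℤ
Δ r g = det r (unitColumns r (distances r g))

sign : ℕ → (ℕ → ℕ) → ℤ
sign r g = -1ℤ ℤ.^ (r * (r ∸ 1) / 2 + sumUpTo r g / 2)

ΔFormula : ℕ → (ℕ → ℕ) → Set
ΔFormula r g = (LegIsArmPlusOne r g → Δ r g ≡ sign r g) × (¬ LegIsArmPlusOne r g → Δ r g ≡ 0ℤ)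

distance-fixed : ∀ g {x} → g x ≡ x → distance g x ≡ 0
distance-fixed g {x} gx≡x = trans (cong (λ y → ∣ y - x ∣) gx≡x) (∣n-n∣≡0 x)

columnOf : ∀ {n x} → x ≤ n → Fin (suc n)
columnOf {n} {x} _ = fromℕ< (s≤s (m∸n≤m n x))

toℕ-columnOf : ∀ {n x} (x≤n : x ≤ n) → toℕ (columnOf x≤n) ≡ n ∸ x
toℕ-columnOf _ = toℕ-fromℕ< _

distances-columnOf : ∀ {n x} g (x≤n : x ≤ n) → distances (suc n) g (columnOf x≤n) ≡ distance g x
distances-columnOf {n} g x≤n = cong (distance g) (trans (cong (n ∸_) (toℕ-columnOf x≤n)) (m∸[m∸n]≡n x≤n))

Δ-noFixedPoint : ∀ n g → (∀ x → x ≤ n → g x ≢ x) → Δ (suc n) g ≡ 0ℤ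
Δ-noFixedPoint n g noFixed = det-unitColumns-noZero n (distances (suc n) g) λ j d≡0 →
  noFixed (n ∸ toℕ j) (m∸n≤m n (toℕ j)) (∣m-n∣≡0⇒m≡n d≡0)

Δ-twoFixedPoints : ∀ r g {x y} → x < y → y < r → g x ≡ x → g y ≡ y → Δ r g ≡ 0ℤ
Δ-twoFixedPoints (suc n) g {x} {y} x<y (s≤s y≤n) gx≡x gy≡y =
  det-unitColumns-twoZeros (suc n) (distances (suc n) g) columns-differ
    (trans (distances-columnOf g x≤n) (distance-fixed g gx≡x))
    (trans (distances-columnOf g y≤n) (distance-fixed g gy≡y))
  where
  x≤n = ≤-trans (<⇒≤ x<y) y≤n
  columns-differ : columnOf x≤n ≢ columnOf y≤n
  columns-differ same = <⇒≢ x<y (∸-cancelˡ-≡ x≤n y≤n (begin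
    n ∸ x                  ≡⟨ toℕ-columnOf x≤n ⟨
    toℕ (columnOf x≤n)     ≡⟨ cong toℕ same ⟩
    toℕ (columnOf y≤n)     ≡⟨ toℕ-columnOf y≤n ⟩
    n ∸ y                  ∎))
    where open ≡-Reasoning

-- At the last x with x < g x, all later rows are shorter than x + 1, so λ′_{x+1} = x + 1.
¬leg-noFixedPoint : ∀ n g → Decreasing (suc n) g → (∀ x → x ≤ n → g x ≢ x) → ¬ LegIsArmPlusOne (suc n) g
¬leg-noFixedPoint n g g↓ noFixed leg with lastSatisfying (λ x → suc x ≤? g x) n (n≢0⇒n>0 (noFixed 0 z≤n))
... | x , x≤n , x<gx , last = <⇒≢ x<gx (suc-injective (begin
  suc x                   ≡⟨ count-threshold (suc x) (suc n) (suc x) g (s≤s x≤n) high low ⟨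
  count (suc n) (suc x) g ≡⟨ leg x (s≤s x≤n) x<gx ⟩
  suc (g x)               ∎))
  where
  open ≡-Reasoning
  high : ∀ y → y < suc x → suc x ≤ g y
  high y (s≤s y≤x) = ≤-trans x<gx (g↓ y x y≤x (s≤s x≤n))
  low : ∀ y → suc x ≤ y → y < suc n → g y < suc x
  low y x<y (s≤s y≤n) = s≤s (afterLast last)
    where
    afterLast : x ≡ n ⊎ ¬ suc (suc x) ≤ g (suc x) → g y ≤ x
    afterLast (inj₁ refl)   = ⊥-elim (<⇒≱ x<y y≤n)
    afterLast (inj₂ x+1≮g) = ≤-trans (g↓ (suc x) y x<y (s≤s y≤n))
      (≤-pred (≤∧≢⇒< (≤-pred (≰⇒> x+1≮g)) (noFixed (suc x) (≤-trans x<y y≤n))))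

diagonal-count : ∀ r g → Decreasing r g → ∀ x → x < r → suc x ≤ g x → suc x ≤ count r (suc x) g
diagonal-count r g g↓ x x<r x<gx = begin
  suc x                                   ≡⟨ count-all (suc x) (suc x) g high ⟨
  count (suc x) (suc x) g                 ≤⟨ m≤m+n _ _ ⟩
  count (suc x) (suc x) g + count (r ∸ suc x) (suc x) (λ y → g (suc x + y))
                                          ≡⟨ count-split (suc x) (r ∸ suc x) (suc x) g ⟨
  count (suc x + (r ∸ suc x)) (suc x) g   ≡⟨ cong (λ l → count l (suc x) g) (m+[n∸m]≡n x<r) ⟩
  count r (suc x) g                       ∎
  where
  open ≤-Reasoning
  high : ∀ y → y < suc x → suc x ≤ g y
  high y (s≤s y≤x) = ≤-trans x<gx (g↓ y x y≤x x<r)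

removeFixedPoint : ℕ → (ℕ → ℕ) → ℕ → ℕ
removeFixedPoint i g a = if ⌊ a <? i ⌋ then g a ∸ 1 else g (suc a)

removeFixedPoint-< : ∀ i g {a} → a < i → removeFixedPoint i g a ≡ g a ∸ 1
removeFixedPoint-< i g {a} a<i with a <? i
... | yes _   = refl
... | no  a≮i = ⊥-elim (a≮i a<i)

removeFixedPoint-≥ : ∀ i g {a} → i ≤ a → removeFixedPoint i g a ≡ g (suc a)
removeFixedPoint-≥ i g {a} i≤a with a <? i
... | yes a<i = ⊥-elim (<⇒≱ a<i i≤a)
... | no  _   = refl

module RemoveFixedPoint (n : ℕ) (g : ℕ → ℕ) (g↓ : Decreasing (suc n) g)
                        (i : ℕ) (i≤n : i ≤ n) (gi≡i : g i ≡ i) where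

  g′ : ℕ → ℕ
  g′ = removeFixedPoint i g

  i≤g : ∀ y → y ≤ i → i ≤ g y
  i≤g y y≤i = subst (_≤ g y) gi≡i (g↓ y i y≤i (s≤s i≤n))

  g≤i : ∀ y → i ≤ y → y ≤ n → g y ≤ i
  g≤i y i≤y y≤n = subst (g y ≤_) gi≡i (g↓ i y i≤y (s≤s y≤n))

  distance-g′-< : ∀ a → a < i → distance g′ a ≡ distance g a ∸ 1
  distance-g′-< a a<i = begin
    ∣ g′ a - a ∣    ≡⟨ cong (λ z → ∣ z - a ∣) (removeFixedPoint-< i g a<i) ⟩
    ∣ g a ∸ 1 - a ∣ ≡⟨ ∣m∸1-n∣≡∣m-n∣∸1 (≤-trans a<i (i≤g a (<⇒≤ a<i))) ⟩
    ∣ g a - a ∣ ∸ 1 ∎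
    where open ≡-Reasoning

  distance-g′-≥ : ∀ a → i ≤ a → a < n → distance g′ a ≡ distance g (suc a) ∸ 1
  distance-g′-≥ a i≤a a<n = begin
    ∣ g′ a - a ∣              ≡⟨ cong (λ z → ∣ z - a ∣) (removeFixedPoint-≥ i g i≤a) ⟩
    ∣ g (suc a) - a ∣         ≡⟨ ∣m-n∣≡∣m-1+n∣∸1 (≤-trans (g≤i (suc a) (m≤n⇒m≤1+n i≤a) a<n) i≤a) ⟩
    ∣ g (suc a) - suc a ∣ ∸ 1 ∎
    where open ≡-Reasoning

  j₀ : Fin (suc n)
  j₀ = columnOf i≤n

  distances-j₀ : distances (suc n) g j₀ ≡ 0
  distances-j₀ = trans (distances-columnOf g i≤n) (distance-fixed g gi≡i)

  fixedPoint-unique : ∀ y → y ≤ n → g y ≡ y → y ≡ i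
  fixedPoint-unique y y≤n gy≡y with ≤-total y i
  ... | inj₁ y≤i = ≤-antisym y≤i (subst (i ≤_) gy≡y (i≤g y y≤i))
  ... | inj₂ i≤y = ≤-antisym (subst (_≤ i) gy≡y (g≤i y i≤y y≤n)) i≤y

  distances-≢j₀ : ∀ j → j ≢ j₀ → distances (suc n) g j ≢ 0
  distances-≢j₀ j j≢j₀ d≡0 = j≢j₀ (toℕ-injective (∸-cancelˡ-≡ (≤-pred (toℕ<n j)) (≤-pred (toℕ<n j₀))
    (begin
      n ∸ toℕ j   ≡⟨ fixedPoint-unique (n ∸ toℕ j) (m∸n≤m n (toℕ j)) (∣m-n∣≡0⇒m≡n d≡0) ⟩
      i           ≡⟨ m∸[m∸n]≡n i≤n ⟨
      n ∸ (n ∸ i) ≡⟨ cong (n ∸_) (toℕ-columnOf i≤n) ⟨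
      n ∸ toℕ j₀  ∎)))
    where open ≡-Reasoning

  distances-punchIn : ∀ b → distances (suc n) g (punchIn j₀ b) ∸ 1 ≡ distances n g′ b
  distances-punchIn b with toℕ b <? toℕ j₀
  ... | yes b<j₀ = begin
    distance g (n ∸ toℕ (punchIn j₀ b)) ∸ 1 ≡⟨ cong (λ z → distance g (n ∸ z) ∸ 1) (toℕ-punchIn-< j₀ b b<j₀) ⟩
    distance g (n ∸ t) ∸ 1                 ≡⟨ cong (λ z → distance g z ∸ 1) (+-∸-assoc 1 t<n) ⟩
    distance g (suc a) ∸ 1                 ≡⟨ distance-g′-≥ a i≤a (∸-monoʳ-< (s≤s z≤n) t<n) ⟨
    distance g′ a                          ∎
    where
    open ≡-Reasoning
    t = toℕ b
    t<n = toℕ<n b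
    a = n ∸ suc t
    i≤a : i ≤ a
    i≤a = m+n≤o⇒m≤o∸n i (subst (_≤ n) (+-comm (suc t) i)
            (m≤o∸n⇒m+n≤o (suc t) i≤n (subst (t <_) (toℕ-columnOf i≤n) b<j₀)))
  ... | no  b≮j₀ = trans (cong (λ z → distance g (n ∸ z) ∸ 1) (toℕ-punchIn-≥ j₀ b (≮⇒≥ b≮j₀)))
                          (sym (distance-g′-< a a<i))
    where
    t = toℕ b
    a = n ∸ suc t
    a<i : a < i
    a<i = begin-strict
      a                  <⟨ n<1+n a ⟩
      suc a              ≡⟨ +-∸-assoc 1 (toℕ<n b) ⟨
      n ∸ t              ≤⟨ ∸-monoʳ-≤ n (subst (_≤ t) (toℕ-columnOf i≤n) (≮⇒≥ b≮j₀)) ⟩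
      n ∸ (n ∸ i)        ≡⟨ m∸[m∸n]≡n i≤n ⟩
      i                  ∎
      where open ≤-Reasoning

  Δ-step : Δ (suc n) g ≡ (-1ℤ ℤ.^ (n ∸ i)) ℤ.* Δ n g′
  Δ-step = trans (det-unitColumns-expand n (distances (suc n) g) j₀ distances-j₀ distances-≢j₀)
    (cong₂ (λ e M → (-1ℤ ℤ.^ e) ℤ.* M) (toℕ-columnOf i≤n)
           (det-cong n λ a b → cong (unit (toℕ a)) (distances-punchIn b)))

  1+n≡i+[1+n∸i] : suc n ≡ i + suc (n ∸ i)
  1+n≡i+[1+n∸i] = sym (trans (+-suc i (n ∸ i)) (cong suc (m+[n∸m]≡n i≤n)))

  g′-after : ∀ x → g′ (i + x) ≡ g (i + suc x)
  g′-after x = trans (removeFixedPoint-≥ i g (m≤m+n i x)) (cong g (sym (+-suc i x)))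

  sumUpTo-step : sumUpTo (suc n) g ≡ sumUpTo n g′ + (i + i)
  sumUpTo-step = begin
    sumUpTo (suc n) g                 ≡⟨ cong (λ l → sumUpTo l g) 1+n≡i+[1+n∸i] ⟩
    sumUpTo (i + suc (n ∸ i)) g       ≡⟨ sumUpTo-split i (suc (n ∸ i)) g ⟩
    sumUpTo i g + (g (i + 0) + after) ≡⟨ cong₂ (λ s x → s + (x + after)) before g[i+0]≡i ⟨
    (sumUpTo i g′ + i) + (i + after)  ≡⟨ regroup (sumUpTo i g′) i after ⟩
    (sumUpTo i g′ + after) + (i + i)  ≡⟨ cong (_+ (i + i)) total′ ⟨
    sumUpTo n g′ + (i + i)            ∎
    where
    open ≡-Reasoning
    after = sumUpTo (n ∸ i) (λ x → g (i + suc x))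
    g[i+0]≡i : i ≡ g (i + 0)
    g[i+0]≡i = sym (trans (cong g (+-identityʳ i)) gi≡i)
    regroup : ∀ s i t → (s + i) + (i + t) ≡ (s + t) + (i + i)
    regroup = solve-∀
    before : sumUpTo i g′ + i ≡ sumUpTo i g
    before = trans (cong (_+ i) (sumUpTo-cong i λ y y<i → removeFixedPoint-< i g y<i))
                   (sumUpTo-pred i g λ y y<i → ≤-trans (s≤s z≤n) (≤-trans y<i (i≤g y (<⇒≤ y<i))))
    total′ : sumUpTo n g′ ≡ sumUpTo i g′ + after
    total′ = begin
      sumUpTo n g′                                      ≡⟨ cong (λ l → sumUpTo l g′) (m+[n∸m]≡n i≤n) ⟨
      sumUpTo (i + (n ∸ i)) g′                          ≡⟨ sumUpTo-split i (n ∸ i) g′ ⟩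
      sumUpTo i g′ + sumUpTo (n ∸ i) (λ x → g′ (i + x)) ≡⟨ cong (sumUpTo i g′ +_)
                                                              (sumUpTo-cong (n ∸ i) λ x _ → g′-after x) ⟩
      sumUpTo i g′ + after                              ∎

  sign-step : (-1ℤ ℤ.^ (n ∸ i)) ℤ.* sign n g′ ≡ sign (suc n) g
  sign-step = begin
    (-1ℤ ℤ.^ (n ∸ i)) ℤ.* (-1ℤ ℤ.^ (A + S))          ≡⟨ ℤP.^-distribˡ-+-* -1ℤ (n ∸ i) (A + S) ⟨
    -1ℤ ℤ.^ ((n ∸ i) + (A + S))                      ≡⟨ -1^[m+[k+k]]≡-1^m ((n ∸ i) + (A + S)) i ⟨
    -1ℤ ℤ.^ (((n ∸ i) + (A + S)) + (i + i))          ≡⟨ cong (-1ℤ ℤ.^_) exponent ⟩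
    -1ℤ ℤ.^ (suc n * n / 2 + sumUpTo (suc n) g / 2) ∎
    where
    open ≡-Reasoning
    A = n * (n ∸ 1) / 2
    S = sumUpTo n g′ / 2
    regroup : ∀ d i A S → (d + (A + S)) + (i + i) ≡ (A + (d + i)) + (S + i)
    regroup = solve-∀
    exponent : ((n ∸ i) + (A + S)) + (i + i) ≡ suc n * n / 2 + sumUpTo (suc n) g / 2
    exponent = begin
      ((n ∸ i) + (A + S)) + (i + i)                          ≡⟨ regroup (n ∸ i) i A S ⟩
      (A + ((n ∸ i) + i)) + (S + i)                          ≡⟨ cong (λ z → (A + z) + (S + i)) (m∸n+n≡m i≤n) ⟩
      (A + n) + (S + i)                                      ≡⟨ cong₂ _+_ ([m+[k+k]]/2≡m/2+k (n * (n ∸ 1)) n)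
                                                                         ([m+[k+k]]/2≡m/2+k (sumUpTo n g′) i) ⟨
      (n * (n ∸ 1) + (n + n)) / 2 + (sumUpTo n g′ + (i + i)) / 2
                                                             ≡⟨ cong₂ (λ a b → a / 2 + b / 2)
                                                                  ([1+n]*n≡n*[n∸1]+[n+n] n) sumUpTo-step ⟨
      suc n * n / 2 + sumUpTo (suc n) g / 2                  ∎

  countAfter : ℕ → ℕ
  countAfter m = count (n ∸ i) m (λ y → g (i + suc y))

  count-g : ∀ m → m ≤ i → count (suc n) m g ≡ i + suc (countAfter m)
  count-g m m≤i = begin
    count (suc n) m g                                     ≡⟨ cong (λ l → count l m g) 1+n≡i+[1+n∸i] ⟩
    count (i + suc (n ∸ i)) m g                           ≡⟨ count-split i (suc (n ∸ i)) m g ⟩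
    count i m g + count (suc (n ∸ i)) m (λ y → g (i + y)) ≡⟨ cong₂ _+_ (count-all i m g high)
                                                               (count-head (n ∸ i) m (λ y → g (i + y)) m≤g[i+0]) ⟩
    i + suc (countAfter m)                                ∎
    where
    open ≡-Reasoning
    high : ∀ y → y < i → m ≤ g y
    high y y<i = ≤-trans m≤i (i≤g y (<⇒≤ y<i))
    m≤g[i+0] : m ≤ g (i + 0)
    m≤g[i+0] = subst (m ≤_) (sym (trans (cong g (+-identityʳ i)) gi≡i)) m≤i

  count-g′ : ∀ m → (∀ y → y < i → suc m ≤ g y) → count n m g′ ≡ i + countAfter m
  count-g′ m high = begin
    count n m g′                                      ≡⟨ cong (λ l → count l m g′) (m+[n∸m]≡n i≤n) ⟨
    count (i + (n ∸ i)) m g′                          ≡⟨ count-split i (n ∸ i) m g′ ⟩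
    count i m g′ + count (n ∸ i) m (λ y → g′ (i + y)) ≡⟨ cong₂ _+_ (count-all i m g′ high′)
                                                           (count-cong (n ∸ i) m λ y _ → g′-after y) ⟩
    i + countAfter m                                  ∎
    where
    open ≡-Reasoning
    high′ : ∀ y → y < i → m ≤ g′ y
    high′ y y<i = subst (m ≤_) (sym (removeFixedPoint-< i g y<i)) (∸-monoˡ-≤ 1 (high y y<i))

  count-g-suc : ∀ x → x < i → suc (suc x) ≤ g x → count (suc n) (suc x) g ≡ suc (count n (suc x) g′)
  count-g-suc x x<i x+2≤gx = begin
    count (suc n) (suc x) g          ≡⟨ count-g (suc x) x<i ⟩
    i + suc (countAfter (suc x))     ≡⟨ +-suc i _ ⟩
    suc (i + countAfter (suc x))     ≡⟨ cong suc (count-g′ (suc x) high) ⟨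
    suc (count n (suc x) g′)         ∎
    where
    open ≡-Reasoning
    high : ∀ y → y < i → suc (suc x) ≤ g y
    high y y<i with y ≤? x
    ... | yes y≤x = ≤-trans x+2≤gx (g↓ y x y≤x (s≤s (≤-trans (<⇒≤ x<i) i≤n)))
    ... | no  y≰x = ≤-trans (s≤s (≰⇒> y≰x)) (≤-trans y<i (i≤g y (<⇒≤ y<i)))

  diagonal-< : ∀ x → x ≤ n → suc x ≤ g x → x < i
  diagonal-< x x≤n x<gx with x <? i
  ... | yes x<i = x<i
  ... | no  x≮i = ⊥-elim (<⇒≱ x<gx (≤-trans (g≤i x (≮⇒≥ x≮i) x≤n) (≮⇒≥ x≮i)))

  leg⇒leg′ : LegIsArmPlusOne (suc n) g → LegIsArmPlusOne n g′
  leg⇒leg′ leg x x<n x<g′x with i ≤? x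
  ... | yes i≤x = ⊥-elim (<⇒≱ x<g′x (begin
    g′ x       ≡⟨ removeFixedPoint-≥ i g i≤x ⟩
    g (suc x)  ≤⟨ g≤i (suc x) (m≤n⇒m≤1+n i≤x) x<n ⟩
    i          ≤⟨ i≤x ⟩
    x          ∎))
    where open ≤-Reasoning
  ... | no  i≰x = begin
    count n (suc x) g′ ≡⟨ suc-injective (trans (sym (count-g-suc x x<i x+2≤gx))
                                               (leg x (s≤s (<⇒≤ x<n)) (<⇒≤ x+2≤gx))) ⟩
    g x                ≡⟨ m+[n∸m]≡n (≤-trans z<s x+2≤gx) ⟨
    suc (g x ∸ 1)      ≡⟨ cong suc (removeFixedPoint-< i g x<i) ⟨
    suc (g′ x)         ∎
    where
    open ≡-Reasoning
    x<i = ≰⇒> i≰x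
    x+2≤gx : suc (suc x) ≤ g x
    x+2≤gx = m<n∸1⇒1+m<n (subst (suc x ≤_) (removeFixedPoint-< i g x<i) x<g′x)

  -- The only way g′ can fail to be decreasing; then g′ has the two fixed points i − 1 and i.
  Collision : Set
  Collision = 1 ≤ i × g (pred i) ≡ i × suc i ≤ n × g (suc i) ≡ i

  collision? : Dec Collision
  collision? = 1 ≤? i ×-dec g (pred i) ℕ.≟ i ×-dec suc i ≤? n ×-dec g (suc i) ℕ.≟ i

  noCollision-drop : ¬ Collision → 1 ≤ i → g (pred i) ≡ i → ∀ y → i < y → y ≤ n → g y < i
  noCollision-drop ¬collision 1≤i g[i-1]≡i y i<y y≤n =
    ≤-<-trans (g↓ (suc i) y i<y (s≤s y≤n))
              (≤∧≢⇒< (g≤i (suc i) (n≤1+n i) i<n) λ g[i+1]≡i → ¬collision (1≤i , g[i-1]≡i , i<n , g[i+1]≡i))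
    where i<n = ≤-trans i<y y≤n

  noCollision-before>after : ¬ Collision → ∀ x y → x < i → i < y → y ≤ n → g y < g x
  noCollision-before>after ¬collision x y x<i i<y y≤n with m≤n⇒m<n∨m≡n (i≤g (pred i) pred[n]≤n)
  ... | inj₁ i<g[i-1] = begin-strict
    g y        ≤⟨ g≤i y (<⇒≤ i<y) y≤n ⟩
    i          <⟨ i<g[i-1] ⟩
    g (pred i) ≤⟨ g↓ x (pred i) (<⇒≤pred x<i) (s≤s (≤-trans pred[n]≤n i≤n)) ⟩
    g x        ∎
    where open ≤-Reasoning
  ... | inj₂ i≡g[i-1] = begin-strict
    g y        <⟨ noCollision-drop ¬collision (≤-trans z<s x<i) (sym i≡g[i-1]) y i<y y≤n ⟩
    i          ≤⟨ i≤g x (<⇒≤ x<i) ⟩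
    g x        ∎
    where open ≤-Reasoning

  g′-decreasing : ¬ Collision → Decreasing n g′
  g′-decreasing ¬collision x y x≤y y<n with i ≤? x | i ≤? y
  ... | yes i≤x | _ =
    subst₂ _≤_ (sym (removeFixedPoint-≥ i g (≤-trans i≤x x≤y))) (sym (removeFixedPoint-≥ i g i≤x))
      (g↓ (suc x) (suc y) (s≤s x≤y) (s≤s y<n))
  ... | no  i≰x | no i≰y =
    subst₂ _≤_ (sym (removeFixedPoint-< i g (≰⇒> i≰y))) (sym (removeFixedPoint-< i g (≰⇒> i≰x)))
      (∸-monoˡ-≤ 1 (g↓ x y x≤y (m≤n⇒m≤1+n y<n)))
  ... | no  i≰x | yes i≤y =
    subst₂ _≤_ (sym (removeFixedPoint-≥ i g i≤y)) (sym (removeFixedPoint-< i g (≰⇒> i≰x)))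
      (∸-monoˡ-≤ 1 (noCollision-before>after ¬collision x (suc y) (≰⇒> i≰x) (s≤s i≤y) y<n))

  noCollision-count : ¬ Collision → 1 ≤ i → g (pred i) ≡ i → count (suc n) i g ≡ suc i
  noCollision-count ¬collision 1≤i g[i-1]≡i = count-threshold (suc i) (suc n) i g (s≤s i≤n)
    (λ y y<1+i → i≤g y (≤-pred y<1+i))
    (λ y i<y y<1+n → noCollision-drop ¬collision 1≤i g[i-1]≡i y i<y (≤-pred y<1+n))

  leg′⇒leg : ¬ Collision → LegIsArmPlusOne n g′ → LegIsArmPlusOne (suc n) g
  leg′⇒leg ¬collision leg′ x (s≤s x≤n) x<gx with suc (suc x) ≤? g x
  ... | yes x+2≤gx = begin
    count (suc n) (suc x) g  ≡⟨ count-g-suc x x<i x+2≤gx ⟩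
    suc (count n (suc x) g′) ≡⟨ cong suc (leg′ x (≤-trans x<i i≤n) x<g′x) ⟩
    suc (suc (g′ x))         ≡⟨ cong (λ z → suc (suc z)) (removeFixedPoint-< i g x<i) ⟩
    suc (suc (g x ∸ 1))      ≡⟨ cong suc (m+[n∸m]≡n (≤-trans z<s x<gx)) ⟩
    suc (g x)                ∎
    where
    open ≡-Reasoning
    x<i = diagonal-< x x≤n x<gx
    x<g′x : suc x ≤ g′ x
    x<g′x = subst (suc x ≤_) (sym (removeFixedPoint-< i g x<i)) (∸-monoˡ-≤ 1 x+2≤gx)
  ... | no  x+2≰gx = begin
    count (suc n) (suc x) g ≡⟨ cong (λ m → count (suc n) m g) i≡1+x ⟨
    count (suc n) i g       ≡⟨ noCollision-count ¬collision (≤-trans z<s x<i) g[i-1]≡i ⟩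
    suc i                   ≡⟨ cong suc (trans i≡1+x (sym gx≡1+x)) ⟩
    suc (g x)               ∎
    where
    open ≡-Reasoning
    x<i = diagonal-< x x≤n x<gx
    gx≡1+x : g x ≡ suc x
    gx≡1+x = ≤-antisym (≤-pred (≰⇒> x+2≰gx)) x<gx
    i≡1+x : i ≡ suc x
    i≡1+x = ≤-antisym (subst (i ≤_) gx≡1+x (i≤g x (<⇒≤ x<i))) x<i
    g[i-1]≡i : g (pred i) ≡ i
    g[i-1]≡i = trans (cong (g ∘ pred) i≡1+x) (trans gx≡1+x (sym i≡1+x))

  collision⇒¬leg : Collision → ¬ LegIsArmPlusOne (suc n) g
  collision⇒¬leg (1≤i , g[i-1]≡i , i<n , g[i+1]≡i) leg = <⇒≢ someAfter (sym noneAfter)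
    where
    i-1<1+n : pred i < suc n
    i-1<1+n = s≤s (≤-trans pred[n]≤n i≤n)
    diagonal : suc (pred i) ≤ g (pred i)
    diagonal = ≤-reflexive (trans (1+pred 1≤i) (sym g[i-1]≡i))
    noneAfter : countAfter i ≡ 0
    noneAfter = suc-injective (+-cancelˡ-≡ i _ _ (begin
      i + suc (countAfter i)          ≡⟨ count-g i ≤-refl ⟨
      count (suc n) i g               ≡⟨ cong (λ m → count (suc n) m g) (1+pred 1≤i) ⟨
      count (suc n) (suc (pred i)) g  ≡⟨ leg (pred i) i-1<1+n diagonal ⟩
      suc (g (pred i))                ≡⟨ cong suc g[i-1]≡i ⟩
      suc i                           ≡⟨ +-comm 1 i ⟩
      i + 1                           ∎))
      where open ≡-Reasoning
    someAfter : 0 < countAfter i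
    someAfter = count-pos (n ∸ i) i (λ y → g (i + suc y)) 0 (m<n⇒0<n∸m i<n)
                  (≤-reflexive (sym (trans (cong g (+-comm i 1)) g[i+1]≡i)))

  collision⇒Δ′≡0 : Collision → Δ n g′ ≡ 0ℤ
  collision⇒Δ′≡0 (1≤i , g[i-1]≡i , i<n , g[i+1]≡i) = Δ-twoFixedPoints n g′ i-1<i i<n
    (begin
      g′ (pred i)    ≡⟨ removeFixedPoint-< i g i-1<i ⟩
      g (pred i) ∸ 1 ≡⟨ cong (_∸ 1) g[i-1]≡i ⟩
      i ∸ 1          ≡⟨ pred[m∸n]≡m∸[1+n] i 0 ⟨
      pred i         ∎)
    (trans (removeFixedPoint-≥ i g ≤-refl) g[i+1]≡i)
    where
    open ≡-Reasoning
    i-1<i : pred i < i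
    i-1<i = ≤-reflexive (1+pred 1≤i)

  Δ-step-0 : Δ n g′ ≡ 0ℤ → Δ (suc n) g ≡ 0ℤ
  Δ-step-0 Δ′≡0 = trans Δ-step
    (trans (cong ((-1ℤ ℤ.^ (n ∸ i)) ℤ.*_) Δ′≡0) (ℤP.*-zeroʳ (-1ℤ ℤ.^ (n ∸ i))))

  ΔFormula-step : (∀ h → Decreasing n h → ΔFormula n h) → ΔFormula (suc n) g
  ΔFormula-step ih with collision?
  ... | yes collision = ⊥-elim ∘ collision⇒¬leg collision , λ _ → Δ-step-0 (collision⇒Δ′≡0 collision)
  ... | no ¬collision = withLeg , λ ¬leg → Δ-step-0 (proj₂ ih′ (¬leg ∘ leg′⇒leg ¬collision))
    where
    ih′ = ih g′ (g′-decreasing ¬collision)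
    withLeg : LegIsArmPlusOne (suc n) g → Δ (suc n) g ≡ sign (suc n) g
    withLeg leg = begin
      Δ (suc n) g                         ≡⟨ Δ-step ⟩
      (-1ℤ ℤ.^ (n ∸ i)) ℤ.* Δ n g′        ≡⟨ cong ((-1ℤ ℤ.^ (n ∸ i)) ℤ.*_) (proj₁ ih′ (leg⇒leg′ leg)) ⟩
      (-1ℤ ℤ.^ (n ∸ i)) ℤ.* sign n g′     ≡⟨ sign-step ⟩
      sign (suc n) g                      ∎
      where open ≡-Reasoning

Δ-formula : ∀ r g → Decreasing r g → ΔFormula r g
Δ-formula zero    g _  = (λ _ → refl) , (λ ¬leg → ⊥-elim (¬leg λ _ ()))
Δ-formula (suc n) g g↓ with anyUpTo? (λ x → g x ℕ.≟ x) (suc n)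
... | yes (i , s≤s i≤n , gi≡i) = RemoveFixedPoint.ΔFormula-step n g g↓ i i≤n gi≡i (Δ-formula n)
... | no  ∄fixed = ⊥-elim ∘ ¬leg-noFixedPoint n g g↓ noFixed , λ _ → Δ-noFixedPoint n g noFixed
  where
  noFixed : ∀ x → x ≤ n → g x ≢ x
  noFixed x x≤n gx≡x = ∄fixed (x , s≤s x≤n , gx≡x)

Dmat-unit : ∀ r k c → Dmat r k c ≡ unit (toℕ k) ∣ toℕ c - (r ∸ 1) ∣
Dmat-unit (suc m) k c with toℕ k | toℕ<n k
... | zero | _ with toℕ c ℕ.≟ m
...   | yes c≡m  = sym (trans (cong (unit 0) (trans (cong (λ z → ∣ z - m ∣) c≡m) (∣n-n∣≡0 m))) (unit-refl 0))
...   | no  c≢m  = sym (unit-≢ λ 0≡d → c≢m (∣m-n∣≡0⇒m≡n (sym 0≡d)))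
Dmat-unit (suc m) k c | suc k′ | s≤s k′<m rewrite +-comm k′ 2
  with toℕ c ℕ.≟ m ∸ suc k′ | toℕ c ℕ.≟ suc m + k′
...   | yes c≡₁  | _        = sym (trans (cong (λ z → unit (suc k′) ∣ z - m ∣) c≡₁)
                                   (trans (cong (unit (suc k′)) (∣m∸[1+k]-m∣≡1+k k′<m)) (unit-refl (suc k′))))
...   | no  _    | yes c≡₂  = sym (trans (cong (λ z → unit (suc k′) ∣ z - m ∣) c≡₂)
                                   (trans (cong (unit (suc k′)) (∣1+m+k-m∣≡1+k k′ m)) (unit-refl (suc k′))))
...   | no  c≢₁  | no  c≢₂  = sym (unit-≢ λ 1+k′≡d → [ c≢₁ , c≢₂ ] (∣x-m∣≡1+k⇒ (sym 1+k′≡d)))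

extend : ∀ {r} → (Fin r → ℕ) → ℕ → ℕ
extend {r} λ′ k with k <? r
... | yes k<r = λ′ (fromℕ< k<r)
... | no  _   = 0

extend-toℕ : ∀ {r} (λ′ : Fin r → ℕ) i → extend λ′ (toℕ i) ≡ λ′ i
extend-toℕ {r} λ′ i with toℕ i <? r
... | yes i<r = cong λ′ (fromℕ<-toℕ i i<r)
... | no  i≮r = ⊥-elim (i≮r (toℕ<n i))

extend-fromℕ< : ∀ {r} (λ′ : Fin r → ℕ) {k} (k<r : k < r) → extend λ′ k ≡ λ′ (fromℕ< k<r)
extend-fromℕ< λ′ k<r = trans (cong (extend λ′) (sym (toℕ-fromℕ< k<r))) (extend-toℕ λ′ (fromℕ< k<r))

countGE≡count : ∀ r m (λ′ : Fin r → ℕ) (g : ℕ → ℕ) → (∀ i → λ′ i ≡ g (toℕ i)) → countGE r m λ′ ≡ count r m g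
countGE≡count zero    m λ′ g λ′≗g = refl
countGE≡count (suc r) m λ′ g λ′≗g rewrite λ′≗g zero =
  cong (_ +_) (countGE≡count r m (λ′ ∘ suc) (g ∘ suc) (λ′≗g ∘ suc))

size≡sumUpTo : ∀ r (λ′ : Fin r → ℕ) (g : ℕ → ℕ) → (∀ i → λ′ i ≡ g (toℕ i)) → size r λ′ ≡ sumUpTo r g
size≡sumUpTo zero    λ′ g λ′≗g = refl
size≡sumUpTo (suc r) λ′ g λ′≗g = cong₂ _+_ (λ′≗g zero) (size≡sumUpTo r (λ′ ∘ suc) (g ∘ suc) (λ′≗g ∘ suc))

module FromPartition {r : ℕ} (λ′ : Fin r → ℕ) (partition : IsPartition r λ′) where

  g : ℕ → ℕ
  g = extend λ′

  λ′≗g : ∀ i → λ′ i ≡ g (toℕ i)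
  λ′≗g i = sym (extend-toℕ λ′ i)

  g↓ : Decreasing r g
  g↓ x y x≤y y<r = subst₂ _≤_ (sym (extend-fromℕ< λ′ y<r)) (sym (extend-fromℕ< λ′ x<r))
    (partition (fromℕ< x<r) (fromℕ< y<r) (subst₂ ℕ._≤_ (sym (toℕ-fromℕ< x<r)) (sym (toℕ-fromℕ< y<r)) x≤y))
    where x<r = ≤-<-trans x≤y y<r

  count≡ : ∀ m → countGE r m λ′ ≡ count r m g
  count≡ m = countGE≡count r m λ′ g λ′≗g

  legAt⇒InPAt : ∀ i → OnDiagonal r λ′ i → count r (suc (toℕ i)) g ≡ suc (g (toℕ i)) →
                frobβ r λ′ i ≡ frobα r λ′ i + 1
  legAt⇒InPAt i diagonal leg = begin
    countGE r (suc t) λ′ ∸ suc t    ≡⟨ cong (_∸ suc t) (trans (count≡ (suc t)) leg) ⟩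
    suc (g t) ∸ suc t               ≡⟨ 1+n∸o≡n∸o+1 (subst (suc t ≤_) (λ′≗g i) diagonal) ⟩
    g t ∸ suc t + 1                 ≡⟨ cong (λ z → z ∸ suc t + 1) (λ′≗g i) ⟨
    λ′ i ∸ suc t + 1                ∎
    where
    open ≡-Reasoning
    t = toℕ i

  InPAt⇒legAt : ∀ i → suc (toℕ i) ≤ g (toℕ i) → frobβ r λ′ i ≡ frobα r λ′ i + 1 →
                count r (suc (toℕ i)) g ≡ suc (g (toℕ i))
  InPAt⇒legAt i diagonal inP = m∸o≡n∸o+1⇒m≡1+n (diagonal-count r g g↓ t (toℕ<n i) diagonal) diagonal (begin
    count r (suc t) g ∸ suc t       ≡⟨ cong (_∸ suc t) (count≡ (suc t)) ⟨
    countGE r (suc t) λ′ ∸ suc t    ≡⟨ inP ⟩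
    λ′ i ∸ suc t + 1                ≡⟨ cong (λ z → z ∸ suc t + 1) (λ′≗g i) ⟩
    g t ∸ suc t + 1                 ∎)
    where
    open ≡-Reasoning
    t = toℕ i

  leg⇒InP : LegIsArmPlusOne r g → InP r λ′
  leg⇒InP leg i diagonal =
    legAt⇒InPAt i diagonal (leg (toℕ i) (toℕ<n i) (subst (suc (toℕ i) ≤_) (λ′≗g i) diagonal))

  InP⇒leg : InP r λ′ → LegIsArmPlusOne r g
  InP⇒leg inP x x<r = subst (λ y → suc y ≤ g y → count r (suc y) g ≡ suc (g y)) (toℕ-fromℕ< x<r)
    λ diagonal → InPAt⇒legAt i diagonal (inP i (subst (suc (toℕ i) ≤_) (sym (λ′≗g i)) diagonal))
    where i = fromℕ< x<r

  distance-Icol : ∀ j → ∣ Icol r λ′ j - (r ∸ 1) ∣ ≡ distances r g j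
  distance-Icol j = begin
    ∣ λ′ (opposite j) + t - (r ∸ 1) ∣ ≡⟨ cong₂ (λ a b → ∣ a + t - b ∣) λ′[j̄]≡gx (sym (m∸[1+n]+n≡m∸1 (toℕ<n j))) ⟩
    ∣ g x + t - (x + t) ∣             ≡⟨ cong₂ ∣_-_∣ (+-comm (g x) t) (+-comm x t) ⟩
    ∣ t + g x - (t + x) ∣             ≡⟨ ∣m+n-m+o∣≡∣n-o∣ t (g x) x ⟩
    ∣ g x - x ∣                       ∎
    where
    open ≡-Reasoning
    t = toℕ j
    x = r ∸ suc t
    λ′[j̄]≡gx : λ′ (opposite j) ≡ g x
    λ′[j̄]≡gx = trans (λ′≗g (opposite j)) (cong g (opposite-prop j))

  InRange : Set
  InRange = ∀ j → Icol r λ′ j < 2 * r ∸ 1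

  inRange? : Dec InRange
  inRange? = all? λ j → Icol r λ′ j <? (2 * r ∸ 1)

  leg⇒inRange : LegIsArmPlusOne r g → InRange
  leg⇒inRange leg j = m<r⇒n<r⇒m+n<2r∸1 (≤-<-trans λ′[j̄]≤g0 g0<r) (toℕ<n j)
    where
    0<r = ≤-<-trans z≤n (toℕ<n j)
    λ′[j̄]≤g0 : λ′ (opposite j) ≤ g 0
    λ′[j̄]≤g0 = subst (_≤ g 0) (sym (λ′≗g (opposite j))) (g↓ 0 _ z≤n (toℕ<n (opposite j)))
    g0<r : g 0 < r
    g0<r with r ≤? g 0
    ... | no  r≰g0 = ≰⇒> r≰g0
    ... | yes r≤g0 = ⊥-elim (<⇒≱ (s≤s r≤g0) (begin
      suc (g 0)        ≡⟨ leg 0 0<r (≤-trans 0<r r≤g0) ⟨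
      count r 1 g      ≤⟨ count-≤ r 1 g ⟩
      r                ∎))
      where open ≤-Reasoning

  detΔ-inRange : InRange → detΔ r λ′ ≡ Δ r g
  detΔ-inRange inRange with all? (λ j → Icol r λ′ j <? (2 * r ∸ 1))
  ... | no  outOfRange = ⊥-elim (outOfRange inRange)
  ... | yes inRange′   = det-cong r λ k j → trans (Dmat-unit r k _)
    (cong (unit (toℕ k)) (trans (cong (λ c → ∣ c - (r ∸ 1) ∣) (toℕ-fromℕ< (inRange′ j))) (distance-Icol j)))

  detΔ-outOfRange : ¬ InRange → detΔ r λ′ ≡ 0ℤ
  detΔ-outOfRange outOfRange with all? (λ j → Icol r λ′ j <? (2 * r ∸ 1))
  ... | yes inRange = ⊥-elim (outOfRange inRange)
  ... | no  _       = refl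

  sign≡signP : sign r g ≡ signP r λ′
  sign≡signP = cong (λ s → -1ℤ ℤ.^ (r * (r ∸ 1) / 2 + s / 2)) (sym (size≡sumUpTo r λ′ g λ′≗g))

mainTheorem3 : ∀ (r : ℕ) → 1 ≤ r → (λ′ : Fin r → ℕ) → IsPartition r λ′ →
    (InP r λ′ → detΔ r λ′ ≡ signP r λ′) × (¬ InP r λ′ → detΔ r λ′ ≡ 0ℤ)
mainTheorem3 r _ λ′ partition = inP⇒sign , ¬inP⇒0
  where
  open FromPartition λ′ partition
  formula = Δ-formula r g g↓
  inP⇒sign : InP r λ′ → detΔ r λ′ ≡ signP r λ′
  inP⇒sign inP = begin
    detΔ r λ′   ≡⟨ detΔ-inRange (leg⇒inRange (InP⇒leg inP)) ⟩
    Δ r g       ≡⟨ proj₁ formula (InP⇒leg inP) ⟩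
    sign r g    ≡⟨ sign≡signP ⟩
    signP r λ′  ∎
    where open ≡-Reasoning
  ¬inP⇒0 : ¬ InP r λ′ → detΔ r λ′ ≡ 0ℤ
  ¬inP⇒0 ¬inP = byRange inRange?
    where
    byRange : Dec InRange → detΔ r λ′ ≡ 0ℤ
    byRange (yes inRange)    = trans (detΔ-inRange inRange) (proj₂ formula (¬inP ∘ leg⇒InP))
    byRange (no  outOfRange) = detΔ-outOfRange outOfRange
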